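{- Let $A$ be any $\mathcal{L}(\Box,\mathbf{I})$-formula, and let $L$ range over logics (sets of $\mathcal{L}(\Box,\rhd)$-formulas closed under the rules of $\mathbf{IL}^-$). (1) If $\mathbf{IL}^-\subseteq L\subseteq\mathbf{IL}^-(\mathbf{J5})$, then $L\vdash A$ iff $\mathbf{il}^-\vdash A$. (2) If $\mathbf{IL}^-(\mathbf{J4}_+)\subseteq L\subseteq\mathbf{IL}^-(\mathbf{J4}_+,\mathbf{J5})$ or $\mathbf{IL}^-(\mathbf{J4}_+)\subseteq L\subseteq\mathbf{IL}^-(\mathbf{J2}_+)$, then $L\vdash A$ iff $\mathbf{il}^-(\mathbf{I2})\vdash A$. (3) If $\mathbf{IL}^-(\mathbf{J1},\mathbf{J4}_+)\subseteq L\subseteq\mathbf{CL}$, then $L\vdash A$ iff $\mathbf{il}^-(\mathbf{J1}^u,\mathbf{I2})\vdash A$.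
   Context: The language $\mathcal{L}(\Box,\rhd)$ consists of propositional variables, $\bot$, $\to$, unary $\Box$ and binary $\rhd$; other connectives as usual, $\Diamond A:\equiv\neg\Box\neg A$, $\mathbf{I}A:\equiv\top\rhd A$; $\mathcal{L}(\Box,\mathbf{I})$-formulas are those built from variables and $\bot$ by $\to$, $\Box$, $\mathbf{I}$. The logic $\mathbf{IL}^-$ has as axioms all tautologies, $\Box(A\to B)\to(\Box A\to\Box B)$, $\Box(\Box A\to A)\to\Box A$, $\mathbf{J3}$: $(A\rhd C)\land(B\rhd C)\to(A\lor B)\rhd C$, $\mathbf{J6}$: $\Box A\leftrightarrow(\neg A\rhd\bot)$; rules: Modus Ponens, Necessitation, from $A\to B$ infer $(C\rhd A)\to(C\rhd B)$, and from $A\to B$ infer $(B\rhd C)\to(A\rhd C)$. Schemata: $\mathbf{J1}$: $\Box(A\to B)\to A\rhd B$; $\mathbf{J2}_+$: $(A\rhd(B\lor C))\land(B\rhd C)\to A\rhd C$; $\mathbf{J4}_+$: $\Box(A\to B)\to(C\rhd A\to C\rhd B)$; $\mathbf{J5}$: $\Diamond A\rhd A$. $L(\Sigma_1,\dots,\Sigma_k)$ is $L$ with schemata $\Sigma_i$ added as axioms; $\mathbf{CL}:=\mathbf{IL}^-(\mathbf{J1},\mathbf{J2}_+)$. Inclusions between logics refer to their sets of theorems. The logic $\mathbf{il}^-$ has as axioms all tautologies of $\mathcal{L}(\Box,\mathbf{I})$, $\Box(A\to B)\to(\Box A\to\Box B)$, $\Box(\Box A\to A)\to\Box A$, $\Box\bot\leftrightarrow\mathbf{I}\bot$;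 rules Modus Ponens, Necessitation, and from $A\to B$ infer $\mathbf{I}A\to\mathbf{I}B$. Schemata: $\mathbf{I2}$: $\Box(A\to B)\to(\mathbf{I}A\to\mathbf{I}B)$; $\mathbf{J1}^u$: $\Box A\to\mathbf{I}A$. -}

module Defs where

open import Data.Nat using (ℕ)
open import Data.Bool using (Bool; true; false; not; _∨_)
open import Data.Empty using (⊥)
open import Data.Sum using (_⊎_)
open import Data.Product using (∃; ∃₂; _×_)
open import Relation.Binary.PropositionalEquality using (_≡_)

infixr 5 _⇒_
infix 6 _▷_

data Fm : Set where
  var : ℕ → Fm
  ⊥'  : Fm
  _⇒_ : Fm → Fm → Fm
  □   : Fm → Fm
  _▷_ : Fm → Fm → Fm

¬' : Fm → Fm
¬' A = A ⇒ ⊥'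

⊤' : Fm
⊤' = ¬' ⊥'

_∨'_ : Fm → Fm → Fm
A ∨' B = ¬' A ⇒ B

_∧'_ : Fm → Fm → Fm
A ∧' B = ¬' (A ⇒ ¬' B)

_⇔'_ : Fm → Fm → Fm
A ⇔' B = (A ⇒ B) ∧' (B ⇒ A)

◇ : Fm → Fm
◇ A = ¬' (□ (¬' A))

I : Fm → Fm
I A = ⊤' ▷ A

eval : (Fm → Bool) → Fm → Bool
eval v (var n) = v (var n)
eval v ⊥' = false
eval v (A ⇒ B) = not (eval v A) ∨ eval v B
eval v (□ A) = v (□ A)
eval v (A ▷ B) = v (A ▷ B)

Taut : Fm → Set
Taut A = ∀ (v : Fm → Bool) → eval v A ≡ true

data _⊢_ (Ax : Fm → Set) : Fm → Set where
  taut : ∀ {A} → Taut A → Ax ⊢ A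
  axK  : ∀ {A B} → Ax ⊢ (□ (A ⇒ B) ⇒ (□ A ⇒ □ B))
  axL  : ∀ {A} → Ax ⊢ (□ (□ A ⇒ A) ⇒ □ A)
  axJ3 : ∀ {A B C} → Ax ⊢ (((A ▷ C) ∧' (B ▷ C)) ⇒ ((A ∨' B) ▷ C))
  axJ6 : ∀ {A} → Ax ⊢ (□ A ⇔' (¬' A ▷ ⊥'))
  extra : ∀ {A} → Ax A → Ax ⊢ A
  mp   : ∀ {A B} → Ax ⊢ (A ⇒ B) → Ax ⊢ A → Ax ⊢ B
  nec  : ∀ {A} → Ax ⊢ A → Ax ⊢ □ A
  r1   : ∀ {A B C} → Ax ⊢ (A ⇒ B) → Ax ⊢ ((C ▷ A) ⇒ (C ▷ B))
  r2   : ∀ {A B C} → Ax ⊢ (A ⇒ B) → Ax ⊢ ((B ▷ C) ⇒ (A ▷ C))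

None : Fm → Set
None _ = ⊥

J1 : Fm → Set
J1 F = ∃₂ λ A B → F ≡ (□ (A ⇒ B) ⇒ (A ▷ B))

J2₊ : Fm → Set
J2₊ F = ∃₂ λ A B → ∃ λ C → F ≡ (((A ▷ (B ∨' C)) ∧' (B ▷ C)) ⇒ (A ▷ C))

J4₊ : Fm → Set
J4₊ F = ∃₂ λ A B → ∃ λ C → F ≡ (□ (A ⇒ B) ⇒ ((C ▷ A) ⇒ (C ▷ B)))

J5 : Fm → Set
J5 F = ∃ λ A → F ≡ (◇ A ▷ A)

_∪_ : (Fm → Set) → (Fm → Set) → Fm → Set
(S ∪ T) F = S F ⊎ T F

Th : (Fm → Set) → Fm → Set
Th Ax F = Ax ⊢ F

IL⁻ : Fm → Set
IL⁻ = Th None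

CL : Fm → Set
CL = Th (J1 ∪ J2₊)

_⊆_ : (Fm → Set) → (Fm → Set) → Set
S ⊆ T = ∀ F → S F → T F

record IsLogic (L : Fm → Set) : Set where
  field
    closed-mp  : ∀ {A B} → L (A ⇒ B) → L A → L B
    closed-nec : ∀ {A} → L A → L (□ A)
    closed-r1  : ∀ {A B C} → L (A ⇒ B) → L ((C ▷ A) ⇒ (C ▷ B))
    closed-r2  : ∀ {A B C} → L (A ⇒ B) → L ((B ▷ C) ⇒ (A ▷ C))

data FmI : Set where
  var : ℕ → FmI
  ⊥'  : FmI
  _⇒_ : FmI → FmI → FmI
  □   : FmI → FmI
  𝐈   : FmI → FmI

¬ᵢ : FmI → FmI
¬ᵢ A = A ⇒ ⊥'

_∧ᵢ_ : FmI → FmI → FmI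
A ∧ᵢ B = ¬ᵢ (A ⇒ ¬ᵢ B)

_⇔ᵢ_ : FmI → FmI → FmI
A ⇔ᵢ B = (A ⇒ B) ∧ᵢ (B ⇒ A)

tr : FmI → Fm
tr (var n) = var n
tr ⊥' = ⊥'
tr (A ⇒ B) = tr A ⇒ tr B
tr (□ A) = □ (tr A)
tr (𝐈 A) = I (tr A)

evalᵢ : (FmI → Bool) → FmI → Bool
evalᵢ v (var n) = v (var n)
evalᵢ v ⊥' = false
evalᵢ v (A ⇒ B) = not (evalᵢ v A) ∨ evalᵢ v B
evalᵢ v (□ A) = v (□ A)
evalᵢ v (𝐈 A) = v (𝐈 A)

Tautᵢ : FmI → Set
Tautᵢ A = ∀ (v : FmI → Bool) → evalᵢ v A ≡ true

data _⊢ᵢ_ (Ax : FmI → Set) : FmI → Set where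
  taut : ∀ {A} → Tautᵢ A → Ax ⊢ᵢ A
  axK  : ∀ {A B} → Ax ⊢ᵢ (□ (A ⇒ B) ⇒ (□ A ⇒ □ B))
  axL  : ∀ {A} → Ax ⊢ᵢ (□ (□ A ⇒ A) ⇒ □ A)
  axI  : Ax ⊢ᵢ (□ ⊥' ⇔ᵢ 𝐈 ⊥')
  extra : ∀ {A} → Ax A → Ax ⊢ᵢ A
  mp   : ∀ {A B} → Ax ⊢ᵢ (A ⇒ B) → Ax ⊢ᵢ A → Ax ⊢ᵢ B
  nec  : ∀ {A} → Ax ⊢ᵢ A → Ax ⊢ᵢ □ A
  rI   : ∀ {A B} → Ax ⊢ᵢ (A ⇒ B) → Ax ⊢ᵢ (𝐈 A ⇒ 𝐈 B)

Noneᵢ : FmI → Set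
Noneᵢ _ = ⊥

I2 : FmI → Set
I2 F = ∃₂ λ A B → F ≡ (□ (A ⇒ B) ⇒ (𝐈 A ⇒ 𝐈 B))

J1ᵘ : FmI → Set
J1ᵘ F = ∃ λ A → F ≡ (□ A ⇒ 𝐈 A)

_∪ᵢ_ : (FmI → Set) → (FmI → Set) → FmI → Set
(S ∪ᵢ T) F = S F ⊎ T F

module Submission where

-- The inclusions il⁻(Ax) ⊆ L are immediate: tr sends □⊥ ↔ 𝐈⊥ to an instance of J6, I2 to an
-- instance of J4₊ with C := ⊤, and J1ᵘ follows from J1.  For the converse, read C ▷ D inside
-- L(□,𝐈) as  □(C → X D) ∨ 𝐈 D,  with X := ◇ for the logics below IL⁻(J4₊,J5), X := ⊥ (that is,
-- □¬C ∨ 𝐈 D) for those below IL⁻(J2₊), and X := id for those below CL.  Each reading sends every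
-- theorem of the upper bound to a theorem of the corresponding il-logic, and it fixes the image
-- of tr up to provable equivalence, because it makes ⊤ ▷ D equivalent to 𝐈 D: one direction is
-- trivial, the other needs Löb's axiom for X = ◇ and J1ᵘ for X = id.

open import Defs
open import Data.Bool using (Bool; true; false; not; _∨_; _∧_)
open import Data.Bool.Properties using (∧-conicalˡ; ∧-conicalʳ)
open import Data.Fin using (Fin; zero; suc)
open import Data.Nat using (ℕ; zero; suc)
open import Data.Product using (_×_; _,_; proj₁)
open import Data.Sum using (_⊎_; inj₁; inj₂; [_,_])
open import Data.Vec using (Vec; []; _∷_; lookup; map)
open import Data.Vec.Properties using (lookup-map)
open import Function.Base using (_∘_)
open import Function.Bundles using (_⇔_; mk⇔)
open import Relation.Binary.PropositionalEquality using (_≡_; refl; sym; trans; cong₂)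

-- Propositional schemata, instantiated by FmI-formulas; their validity is checked by evaluation.

infixr 5 _⟶_

data Schema (n : ℕ) : Set where
  var : Fin n → Schema n
  ⊥ˢ  : Schema n
  _⟶_ : Schema n → Schema n → Schema n

p₀ : ∀ {n} → Schema (suc n)
p₀ = var zero

p₁ : ∀ {n} → Schema (suc (suc n))
p₁ = var (suc zero)

p₂ : ∀ {n} → Schema (suc (suc (suc n)))
p₂ = var (suc (suc zero))

p₃ : ∀ {n} → Schema (suc (suc (suc (suc n))))
p₃ = var (suc (suc (suc zero)))

p₄ : ∀ {n} → Schema (suc (suc (suc (suc (suc n)))))
p₄ = var (suc (suc (suc (suc zero))))

¬ˢ : ∀ {n} → Schema n → Schema n
¬ˢ p = p ⟶ ⊥ˢ

_∨ˢ_ : ∀ {n} → Schema n → Schema n → Schema n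
p ∨ˢ q = ¬ˢ p ⟶ q

_∧ˢ_ : ∀ {n} → Schema n → Schema n → Schema n
p ∧ˢ q = ¬ˢ (p ⟶ ¬ˢ q)

_⇔ˢ_ : ∀ {n} → Schema n → Schema n → Schema n
p ⇔ˢ q = (p ⟶ q) ∧ˢ (q ⟶ p)

instantiate : ∀ {n} → Vec FmI n → Schema n → FmI
instantiate σ (var i) = lookup σ i
instantiate σ ⊥ˢ = ⊥'
instantiate σ (p ⟶ q) = instantiate σ p ⇒ instantiate σ q

evalˢ : ∀ {n} → Vec Bool n → Schema n → Bool
evalˢ ρ (var i) = lookup ρ i
evalˢ ρ ⊥ˢ = false
evalˢ ρ (p ⟶ q) = not (evalˢ ρ p) ∨ evalˢ ρ q

all : ∀ n → (Vec Bool n → Bool) → Bool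
all zero f = f []
all (suc n) f = all n (λ ρ → f (true ∷ ρ)) ∧ all n (λ ρ → f (false ∷ ρ))

all-sound : ∀ n f → all n f ≡ true → ∀ ρ → f ρ ≡ true
all-sound zero f h [] = h
all-sound (suc n) f h (true ∷ ρ) = all-sound n _ (∧-conicalˡ _ _ h) ρ
all-sound (suc n) f h (false ∷ ρ) = all-sound n _ (∧-conicalʳ _ _ h) ρ

evalᵢ-instantiate : ∀ {n} w (σ : Vec FmI n) p →
                    evalᵢ w (instantiate σ p) ≡ evalˢ (map (evalᵢ w) σ) p
evalᵢ-instantiate w σ (var i) = sym (lookup-map i (evalᵢ w) σ)
evalᵢ-instantiate w σ ⊥ˢ = refl
evalᵢ-instantiate w σ (p ⟶ q) =
  cong₂ (λ x y → not x ∨ y) (evalᵢ-instantiate w σ p) (evalᵢ-instantiate w σ q)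

schema : ∀ {Ax n} (p : Schema n) (σ : Vec FmI n) →
         all n (λ ρ → evalˢ ρ p) ≡ true → Ax ⊢ᵢ instantiate σ p
schema {n = n} p σ valid =
  taut λ w → trans (evalᵢ-instantiate w σ p) (all-sound n _ valid (map (evalᵢ w) σ))

_∨ᵢ_ : FmI → FmI → FmI
A ∨ᵢ B = ¬ᵢ A ⇒ B

⊤ᵢ : FmI
⊤ᵢ = ¬ᵢ ⊥'

◇ᵢ : FmI → FmI
◇ᵢ A = ¬ᵢ (□ (¬ᵢ A))

module _ {Ax : FmI → Set} where

  ⇒-refl : ∀ {a} → Ax ⊢ᵢ (a ⇒ a)
  ⇒-refl {a} = schema (p₀ ⟶ p₀) (a ∷ []) refl

  ⇒-trans : ∀ {a b c} → Ax ⊢ᵢ (a ⇒ b) → Ax ⊢ᵢ (b ⇒ c) → Ax ⊢ᵢ (a ⇒ c)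
  ⇒-trans {a} {b} {c} a⇒b b⇒c =
    mp (mp (schema ((p₀ ⟶ p₁) ⟶ (p₁ ⟶ p₂) ⟶ p₀ ⟶ p₂) (a ∷ b ∷ c ∷ []) refl) a⇒b) b⇒c

  ⇒-mono : ∀ {a a′ b b′} → Ax ⊢ᵢ (a ⇒ a′) → Ax ⊢ᵢ (b′ ⇒ b) → Ax ⊢ᵢ ((a′ ⇒ b′) ⇒ (a ⇒ b))
  ⇒-mono {a} {a′} {b} {b′} a⇒a′ b′⇒b =
    mp (mp (schema ((p₀ ⟶ p₁) ⟶ (p₂ ⟶ p₃) ⟶ (p₁ ⟶ p₂) ⟶ p₀ ⟶ p₃)
                   (a ∷ a′ ∷ b′ ∷ b ∷ []) refl) a⇒a′) b′⇒b

  ∨-mono : ∀ {a a′ b b′} → Ax ⊢ᵢ (a ⇒ a′) → Ax ⊢ᵢ (b ⇒ b′) → Ax ⊢ᵢ ((a ∨ᵢ b) ⇒ (a′ ∨ᵢ b′))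
  ∨-mono {a} {a′} {b} {b′} a⇒a′ b⇒b′ =
    mp (mp (schema ((p₀ ⟶ p₁) ⟶ (p₂ ⟶ p₃) ⟶ (p₀ ∨ˢ p₂) ⟶ (p₁ ∨ˢ p₃))
                   (a ∷ a′ ∷ b ∷ b′ ∷ []) refl) a⇒a′) b⇒b′

  ∨-introˡ : ∀ {a b} → Ax ⊢ᵢ (a ⇒ (a ∨ᵢ b))
  ∨-introˡ {a} {b} = schema (p₀ ⟶ (p₀ ∨ˢ p₁)) (a ∷ b ∷ []) refl

  ∨-introʳ : ∀ {a b} → Ax ⊢ᵢ (b ⇒ (a ∨ᵢ b))
  ∨-introʳ {a} {b} = schema (p₁ ⟶ (p₀ ∨ˢ p₁)) (a ∷ b ∷ []) refl

  ∨-elim : ∀ {a b} → Ax ⊢ᵢ (a ⇒ b) → Ax ⊢ᵢ ((a ∨ᵢ b) ⇒ b)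
  ∨-elim {a} {b} = mp (schema ((p₀ ⟶ p₁) ⟶ (p₀ ∨ˢ p₁) ⟶ p₁) (a ∷ b ∷ []) refl)

  ⊥-elim : ∀ {a} → Ax ⊢ᵢ (⊥' ⇒ a)
  ⊥-elim {a} = schema (⊥ˢ ⟶ p₀) (a ∷ []) refl

  □-mono : ∀ {a b} → Ax ⊢ᵢ (a ⇒ b) → Ax ⊢ᵢ (□ a ⇒ □ b)
  □-mono a⇒b = mp axK (nec a⇒b)

  □-mono₂ : ∀ {a b c} → Ax ⊢ᵢ (a ⇒ (b ⇒ c)) → Ax ⊢ᵢ (□ a ⇒ (□ b ⇒ □ c))
  □-mono₂ a⇒b⇒c = ⇒-trans (□-mono a⇒b⇒c) axK

  ◇-mono : ∀ {a b} → Ax ⊢ᵢ (a ⇒ b) → Ax ⊢ᵢ (◇ᵢ a ⇒ ◇ᵢ b)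
  ◇-mono {a} {b} a⇒b = contraposition (□-mono (contraposition a⇒b))
    where
    contraposition : ∀ {c d} → Ax ⊢ᵢ (c ⇒ d) → Ax ⊢ᵢ (¬ᵢ d ⇒ ¬ᵢ c)
    contraposition {c} {d} = mp (schema ((p₀ ⟶ p₁) ⟶ ¬ˢ p₁ ⟶ ¬ˢ p₀) (c ∷ d ∷ []) refl)

  □-4 : ∀ {a} → Ax ⊢ᵢ (□ a ⇒ □ (□ a))
  □-4 {a} = ⇒-trans (□-mono a⇒□[a∧□a]⇒a∧□a)
                    (⇒-trans axL (□-mono (schema ((p₀ ∧ˢ p₁) ⟶ p₁) (a ∷ □ a ∷ []) refl)))
    where
    a⇒□[a∧□a]⇒a∧□a : Ax ⊢ᵢ (a ⇒ (□ (a ∧ᵢ □ a) ⇒ (a ∧ᵢ □ a)))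
    a⇒□[a∧□a]⇒a∧□a =
      mp (schema ((p₁ ⟶ p₂) ⟶ p₀ ⟶ p₁ ⟶ (p₀ ∧ˢ p₂)) (a ∷ □ (a ∧ᵢ □ a) ∷ □ a ∷ []) refl)
         (□-mono (schema ((p₀ ∧ˢ p₁) ⟶ p₀) (a ∷ □ a ∷ []) refl))

  □⊥⇒𝐈 : ∀ {a} → Ax ⊢ᵢ (□ ⊥' ⇒ 𝐈 a)
  □⊥⇒𝐈 = ⇒-trans (mp (schema ((p₀ ⇔ˢ p₁) ⟶ p₀ ⟶ p₁) (□ ⊥' ∷ 𝐈 ⊥' ∷ []) refl) axI) (rI ⊥-elim)

  𝐈⊥⇒□ : ∀ {a} → Ax ⊢ᵢ (𝐈 ⊥' ⇒ □ a)
  𝐈⊥⇒□ = ⇒-trans (mp (schema ((p₀ ⇔ˢ p₁) ⟶ p₁ ⟶ p₀) (□ ⊥' ∷ 𝐈 ⊥' ∷ []) refl) axI) (□-mono ⊥-elim)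

I2-derivable : (FmI → Set) → Set
I2-derivable Ax = ∀ a b → Ax ⊢ᵢ (□ (a ⇒ b) ⇒ (𝐈 a ⇒ 𝐈 b))

I2-derivable-⊇ : ∀ {Ax} → (∀ {F} → I2 F → Ax F) → I2-derivable Ax
I2-derivable-⊇ I2⊆Ax a b = extra (I2⊆Ax (a , b , refl))

_▷[_]_ : FmI → (FmI → FmI) → FmI → FmI
c ▷[ X ] d = □ (c ⇒ X d) ∨ᵢ 𝐈 d

translate : (FmI → FmI) → Fm → FmI
translate X (var n) = var n
translate X ⊥' = ⊥'
translate X (A ⇒ B) = translate X A ⇒ translate X B
translate X (□ A) = □ (translate X A)
translate X (A ▷ B) = translate X A ▷[ X ] translate X B

eval-translate : ∀ X w A → eval (λ F → evalᵢ w (translate X F)) A ≡ evalᵢ w (translate X A)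
eval-translate X w (var n) = refl
eval-translate X w ⊥' = refl
eval-translate X w (A ⇒ B) = cong₂ (λ x y → not x ∨ y) (eval-translate X w A) (eval-translate X w B)
eval-translate X w (□ A) = refl
eval-translate X w (A ▷ B) = refl

module _ {Ax : FmI → Set} (X : FmI → FmI) where

  ▷-J3 : ∀ a b c → Ax ⊢ᵢ (((a ▷[ X ] c) ∧ᵢ (b ▷[ X ] c)) ⇒ ((¬ᵢ a ⇒ b) ▷[ X ] c))
  ▷-J3 a b c = mp (schema ((p₀ ⟶ p₁ ⟶ p₂) ⟶ ((p₀ ∨ˢ p₃) ∧ˢ (p₁ ∨ˢ p₃)) ⟶ (p₂ ∨ˢ p₃))
                          (□ (a ⇒ X c) ∷ □ (b ⇒ X c) ∷ □ ((¬ᵢ a ⇒ b) ⇒ X c) ∷ 𝐈 c ∷ []) refl)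
                  (□-mono₂ (schema ((p₀ ⟶ p₂) ⟶ (p₁ ⟶ p₂) ⟶ (¬ˢ p₀ ⟶ p₁) ⟶ p₂) (a ∷ b ∷ X c ∷ []) refl))

  ▷-J6 : Ax ⊢ᵢ ¬ᵢ (X ⊥') → ∀ a → Ax ⊢ᵢ (□ a ⇔ᵢ (¬ᵢ a ▷[ X ] ⊥'))
  ▷-J6 ¬X⊥ a = mp (mp (mp (schema ((p₀ ⟶ p₁) ⟶ (p₁ ⟶ p₀) ⟶ (p₂ ⟶ p₀) ⟶ (p₀ ⇔ˢ (p₁ ∨ˢ p₂)))
                                  (□ a ∷ □ (¬ᵢ a ⇒ X ⊥') ∷ 𝐈 ⊥' ∷ []) refl)
                          (□-mono (schema (p₀ ⟶ ¬ˢ p₀ ⟶ p₁) (a ∷ X ⊥' ∷ []) refl)))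
                      □[¬a⇒X⊥]⇒□a)
                  𝐈⊥⇒□
    where
    □[¬a⇒X⊥]⇒□a : Ax ⊢ᵢ (□ (¬ᵢ a ⇒ X ⊥') ⇒ □ a)
    □[¬a⇒X⊥]⇒□a =
      mp (mp (schema ((p₀ ⟶ p₁ ⟶ p₂) ⟶ p₁ ⟶ p₀ ⟶ p₂) (□ (¬ᵢ a ⇒ X ⊥') ∷ □ (¬ᵢ (X ⊥')) ∷ □ a ∷ []) refl)
             (□-mono₂ (schema ((¬ˢ p₀ ⟶ p₁) ⟶ ¬ˢ p₁ ⟶ p₀) (a ∷ X ⊥' ∷ []) refl)))
         (nec ¬X⊥)

  ▷-r1 : (∀ {a b} → Ax ⊢ᵢ (a ⇒ b) → Ax ⊢ᵢ (X a ⇒ X b)) →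
         ∀ {a b c} → Ax ⊢ᵢ (a ⇒ b) → Ax ⊢ᵢ ((c ▷[ X ] a) ⇒ (c ▷[ X ] b))
  ▷-r1 X-mono {a} {b} {c} a⇒b =
    ∨-mono (□-mono (mp (schema ((p₁ ⟶ p₂) ⟶ (p₀ ⟶ p₁) ⟶ p₀ ⟶ p₂) (c ∷ X a ∷ X b ∷ []) refl) (X-mono a⇒b)))
           (rI a⇒b)

  ▷-r2 : ∀ {a b c} → Ax ⊢ᵢ (a ⇒ b) → Ax ⊢ᵢ ((b ▷[ X ] c) ⇒ (a ▷[ X ] c))
  ▷-r2 {a} {b} {c} a⇒b =
    ∨-mono (□-mono (mp (schema ((p₀ ⟶ p₁) ⟶ (p₁ ⟶ p₂) ⟶ p₀ ⟶ p₂) (a ∷ b ∷ X c ∷ []) refl) a⇒b)) ⇒-refl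

  -- J2₊ holds as soon as the □-disjunct of  A ▷ (B ∨ C)  composes with that of  B ▷ C,
  -- and the □-disjunct of  B ▷ C  lets I2 turn 𝐈 (B ∨ C) into 𝐈 C.
  ▷-J2₊ : I2-derivable Ax →
          (∀ a b c → Ax ⊢ᵢ (□ (a ⇒ X (b ∨ᵢ c)) ⇒ (□ (b ⇒ X c) ⇒ □ (a ⇒ X c)))) →
          (∀ b c → Ax ⊢ᵢ (□ (b ⇒ X c) ⇒ □ ((b ∨ᵢ c) ⇒ c))) →
          ∀ a b c → Ax ⊢ᵢ (((a ▷[ X ] (b ∨ᵢ c)) ∧ᵢ (b ▷[ X ] c)) ⇒ (a ▷[ X ] c))
  ▷-J2₊ i2 compose reduce a b c =
    mp (mp (schema ((p₀ ⟶ p₁ ⟶ p₂) ⟶ (p₁ ⟶ p₃ ⟶ p₄) ⟶ ((p₀ ∨ˢ p₃) ∧ˢ (p₁ ∨ˢ p₄)) ⟶ (p₂ ∨ˢ p₄))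
                   (□ (a ⇒ X (b ∨ᵢ c)) ∷ □ (b ⇒ X c) ∷ □ (a ⇒ X c) ∷ 𝐈 (b ∨ᵢ c) ∷ 𝐈 c ∷ []) refl)
           (compose a b c))
       (⇒-trans (reduce b c) (i2 (b ∨ᵢ c) c))

record Interpretation (X : FmI → FmI) (T : Fm → Set) (Ax : FmI → Set) : Set where
  field
    X-mono      : ∀ {a b} → Ax ⊢ᵢ (a ⇒ b) → Ax ⊢ᵢ (X a ⇒ X b)
    ¬X⊥         : Ax ⊢ᵢ ¬ᵢ (X ⊥')
    □[⊤⇒X]⇒𝐈    : ∀ d → Ax ⊢ᵢ (□ (⊤ᵢ ⇒ X d) ⇒ 𝐈 d)
    axioms-hold : ∀ {F} → T F → Ax ⊢ᵢ translate X F

module _ {X T Ax} (𝓘 : Interpretation X T Ax) where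
  open Interpretation 𝓘

  translate-sound : ∀ {A} → T ⊢ A → Ax ⊢ᵢ translate X A
  translate-sound {A} (taut h) =
    taut λ w → trans (sym (eval-translate X w A)) (h (λ F → evalᵢ w (translate X F)))
  translate-sound axK = axK
  translate-sound axL = axL
  translate-sound (axJ3 {A} {B} {C}) = ▷-J3 X (translate X A) (translate X B) (translate X C)
  translate-sound (axJ6 {A}) = ▷-J6 X ¬X⊥ (translate X A)
  translate-sound (extra F) = axioms-hold F
  translate-sound (mp A⇒B A) = mp (translate-sound A⇒B) (translate-sound A)
  translate-sound (nec A) = nec (translate-sound A)
  translate-sound (r1 A⇒B) = ▷-r1 X X-mono (translate-sound A⇒B)
  translate-sound (r2 A⇒B) = ▷-r2 X (translate-sound A⇒B)

  translate-tr : ∀ A → (Ax ⊢ᵢ (translate X (tr A) ⇒ A)) × (Ax ⊢ᵢ (A ⇒ translate X (tr A)))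
  translate-tr (var n) = ⇒-refl , ⇒-refl
  translate-tr ⊥' = ⇒-refl , ⇒-refl
  translate-tr (A ⇒ B) with translate-tr A | translate-tr B
  ... | A′⇒A , A⇒A′ | B′⇒B , B⇒B′ = ⇒-mono A⇒A′ B′⇒B , ⇒-mono A′⇒A B⇒B′
  translate-tr (□ A) with translate-tr A
  ... | A′⇒A , A⇒A′ = □-mono A′⇒A , □-mono A⇒A′
  translate-tr (𝐈 A) with translate-tr A
  ... | A′⇒A , A⇒A′ = ⇒-trans (∨-elim (□[⊤⇒X]⇒𝐈 _)) (rI A′⇒A) , ⇒-trans (rI A⇒A′) ∨-introʳ

  reflect-tr : ∀ {A} → T ⊢ tr A → Ax ⊢ᵢ A
  reflect-tr {A} ⊢trA = mp (proj₁ (translate-tr A)) (translate-sound ⊢trA)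

◇-J5 : ∀ {Ax F} → J5 F → Ax ⊢ᵢ translate ◇ᵢ F
◇-J5 (A , refl) = mp ∨-introˡ (nec ⇒-refl)

◇-J4₊ : ∀ {Ax F} → I2-derivable Ax → J4₊ F → Ax ⊢ᵢ translate ◇ᵢ F
◇-J4₊ {Ax} i2 (A , B , C , refl) = J4₊-instance (translate ◇ᵢ A) (translate ◇ᵢ B) (translate ◇ᵢ C)
  where
  J4₊-instance : ∀ a b c → Ax ⊢ᵢ (□ (a ⇒ b) ⇒ ((c ▷[ ◇ᵢ ] a) ⇒ (c ▷[ ◇ᵢ ] b)))
  J4₊-instance a b c =
    mp (mp (schema ((p₀ ⟶ p₁ ⟶ p₂) ⟶ (p₀ ⟶ p₃ ⟶ p₄) ⟶ p₀ ⟶ (p₁ ∨ˢ p₃) ⟶ (p₂ ∨ˢ p₄))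
                   (□ (a ⇒ b) ∷ □ (c ⇒ ◇ᵢ a) ∷ □ (c ⇒ ◇ᵢ b) ∷ 𝐈 a ∷ 𝐈 b ∷ []) refl)
           (⇒-trans □-4 (⇒-trans (□-mono □[a⇒b]⇒◇a⇒◇b)
             (□-mono₂ (schema ((p₁ ⟶ p₂) ⟶ (p₀ ⟶ p₁) ⟶ p₀ ⟶ p₂) (c ∷ ◇ᵢ a ∷ ◇ᵢ b ∷ []) refl)))))
       (i2 a b)
    where
    □[a⇒b]⇒◇a⇒◇b : Ax ⊢ᵢ (□ (a ⇒ b) ⇒ (◇ᵢ a ⇒ ◇ᵢ b))
    □[a⇒b]⇒◇a⇒◇b =
      mp (schema ((p₀ ⟶ p₁ ⟶ p₂) ⟶ p₀ ⟶ ¬ˢ p₂ ⟶ ¬ˢ p₁) (□ (a ⇒ b) ∷ □ (¬ᵢ b) ∷ □ (¬ᵢ a) ∷ []) refl)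
         (□-mono₂ (schema ((p₀ ⟶ p₁) ⟶ ¬ˢ p₁ ⟶ ¬ˢ p₀) (a ∷ b ∷ []) refl))

-- □(⊤ → ◇D) gives □¬□⊥, hence □⊥ by Löb's axiom.
◇-interpretation : ∀ {T Ax} → (∀ {F} → T F → Ax ⊢ᵢ translate ◇ᵢ F) → Interpretation ◇ᵢ T Ax
◇-interpretation axioms-hold = record
  { X-mono = ◇-mono
  ; ¬X⊥ = mp (schema (p₀ ⟶ ¬ˢ (¬ˢ p₀)) (□ ⊤ᵢ ∷ []) refl) (nec ⇒-refl)
  ; □[⊤⇒X]⇒𝐈 = λ d → ⇒-trans (□-mono (⊤⇒◇d⇒¬□⊥ d)) (⇒-trans axL □⊥⇒𝐈)
  ; axioms-hold = axioms-hold }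
  where
  ⊤⇒◇d⇒¬□⊥ : ∀ {Ax} d → Ax ⊢ᵢ ((⊤ᵢ ⇒ ◇ᵢ d) ⇒ ¬ᵢ (□ ⊥'))
  ⊤⇒◇d⇒¬□⊥ d = mp (schema ((p₀ ⟶ p₁) ⟶ (¬ˢ ⊥ˢ ⟶ ¬ˢ p₁) ⟶ ¬ˢ p₀) (□ ⊥' ∷ □ (¬ᵢ d) ∷ []) refl)
                   (□-mono ⊥-elim)

⊥-interpretation : ∀ {Ax} → I2-derivable Ax → Interpretation (λ _ → ⊥') J2₊ Ax
⊥-interpretation i2 = record
  { X-mono = λ _ → ⇒-refl
  ; ¬X⊥ = ⇒-refl
  ; □[⊤⇒X]⇒𝐈 = λ d → ⇒-trans (□-mono (schema (¬ˢ (¬ˢ ⊥ˢ) ⟶ ⊥ˢ) [] refl)) □⊥⇒𝐈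
  ; axioms-hold = λ { (A , B , C , refl) →
      ▷-J2₊ (λ _ → ⊥') i2
        (λ a b c → schema (p₀ ⟶ p₁ ⟶ p₀) (□ (¬ᵢ a) ∷ □ (¬ᵢ b) ∷ []) refl)
        (λ b c → □-mono (schema (¬ˢ p₀ ⟶ (p₀ ∨ˢ p₁) ⟶ p₁) (b ∷ c ∷ []) refl))
        (translate _ A) (translate _ B) (translate _ C) } }

id-interpretation : ∀ {Ax} → I2-derivable Ax → (∀ a → Ax ⊢ᵢ (□ a ⇒ 𝐈 a)) →
                    Interpretation (λ d → d) (J1 ∪ J2₊) Ax
id-interpretation i2 j1ᵘ = record
  { X-mono = λ a⇒b → a⇒b
  ; ¬X⊥ = ⇒-refl
  ; □[⊤⇒X]⇒𝐈 = λ d → ⇒-trans (j1ᵘ (⊤ᵢ ⇒ d)) (rI (schema ((¬ˢ ⊥ˢ ⟶ p₀) ⟶ p₀) (d ∷ []) refl))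
  ; axioms-hold = λ
      { (inj₁ (A , B , refl)) → ∨-introˡ
      ; (inj₂ (A , B , C , refl)) →
          ▷-J2₊ (λ d → d) i2
            (λ a b c → □-mono₂ (schema ((p₀ ⟶ (p₁ ∨ˢ p₂)) ⟶ (p₁ ⟶ p₂) ⟶ p₀ ⟶ p₂) (a ∷ b ∷ c ∷ []) refl))
            (λ b c → □-mono (schema ((p₀ ⟶ p₁) ⟶ (p₀ ∨ˢ p₁) ⟶ p₁) (b ∷ c ∷ []) refl))
            (translate _ A) (translate _ B) (translate _ C) } }

⊢-mono : ∀ {S T : Fm → Set} → (∀ {F} → S F → T F) → ∀ {A} → S ⊢ A → T ⊢ A
⊢-mono S⊆T (taut h) = taut h
⊢-mono S⊆T axK = axK
⊢-mono S⊆T axL = axL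
⊢-mono S⊆T axJ3 = axJ3
⊢-mono S⊆T axJ6 = axJ6
⊢-mono S⊆T (extra F) = extra (S⊆T F)
⊢-mono S⊆T (mp A⇒B A) = mp (⊢-mono S⊆T A⇒B) (⊢-mono S⊆T A)
⊢-mono S⊆T (nec A) = nec (⊢-mono S⊆T A)
⊢-mono S⊆T (r1 A⇒B) = r1 (⊢-mono S⊆T A⇒B)
⊢-mono S⊆T (r2 A⇒B) = r2 (⊢-mono S⊆T A⇒B)

IL⁻⊆Th : ∀ T → IL⁻ ⊆ Th T
IL⁻⊆Th T F = ⊢-mono (λ ())

eval-tr : ∀ v A → eval v (tr A) ≡ evalᵢ (λ F → v (tr F)) A
eval-tr v (var n) = refl
eval-tr v ⊥' = refl
eval-tr v (A ⇒ B) = cong₂ (λ x y → not x ∨ y) (eval-tr v A) (eval-tr v B)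
eval-tr v (□ A) = refl
eval-tr v (𝐈 A) = refl

module _ {L : Fm → Set} (isL : IsLogic L) (IL⁻⊆L : IL⁻ ⊆ L) where
  open IsLogic isL

  tr-sound : ∀ {Ax} → (∀ {F} → Ax F → L (tr F)) → ∀ {A} → Ax ⊢ᵢ A → L (tr A)
  tr-sound axioms {A} (taut h) = IL⁻⊆L _ (taut λ v → trans (eval-tr v A) (h (λ F → v (tr F))))
  tr-sound axioms axK = IL⁻⊆L _ axK
  tr-sound axioms axL = IL⁻⊆L _ axL
  tr-sound axioms axI = IL⁻⊆L _ (axJ6 {A = ⊥'})
  tr-sound axioms (extra F) = axioms F
  tr-sound axioms (mp A⇒B A) = closed-mp (tr-sound axioms A⇒B) (tr-sound axioms A)
  tr-sound axioms (nec A) = closed-nec (tr-sound axioms A)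
  tr-sound axioms (rI A⇒B) = closed-r1 (tr-sound axioms A⇒B)

tr-I2 : ∀ {F} → I2 F → J4₊ (tr F)
tr-I2 (a , b , refl) = tr a , tr b , ⊤' , refl

tr-J1ᵘ : ∀ {T} → (∀ {F} → J1 F → T F) → ∀ {F} → J1ᵘ F → T ⊢ tr F
tr-J1ᵘ J1⊆T (a , refl) =
  mp (mp (taut (⇒-trans-Taut (□ (tr a)) (□ (⊤' ⇒ tr a)) (⊤' ▷ tr a)))
         (mp axK (nec (taut (weaken-Taut (tr a))))))
     (extra (J1⊆T (⊤' , tr a , refl)))
  where
  weaken-Taut : ∀ A → Taut (A ⇒ (⊤' ⇒ A))
  weaken-Taut A v with eval v A
  ... | true = refl
  ... | false = refl
  ⇒-trans-Taut : ∀ A B C → Taut ((A ⇒ B) ⇒ ((B ⇒ C) ⇒ (A ⇒ C)))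
  ⇒-trans-Taut A B C v with eval v A | eval v B | eval v C
  ... | true  | true  | true  = refl
  ... | true  | true  | false = refl
  ... | true  | false | _     = refl
  ... | false | true  | true  = refl
  ... | false | true  | false = refl
  ... | false | false | _     = refl

IL⁻⊆ : ∀ {T L} → Th T ⊆ L → IL⁻ ⊆ L
IL⁻⊆ T⊆L F = T⊆L F ∘ IL⁻⊆Th _ F

tr-I2∈ : ∀ {L} → Th J4₊ ⊆ L → ∀ {F} → I2 F → L (tr F)
tr-I2∈ J4₊⊆L F = J4₊⊆L _ (extra (tr-I2 F))

tr-J1ᵘ∪I2∈ : ∀ {L} → Th (J1 ∪ J4₊) ⊆ L → ∀ {F} → (J1ᵘ ∪ᵢ I2) F → L (tr F)
tr-J1ᵘ∪I2∈ J1J4₊⊆L = [ (λ F → J1J4₊⊆L _ (tr-J1ᵘ inj₁ F)) , (λ F → J1J4₊⊆L _ (extra (inj₂ (tr-I2 F)))) ]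

conservativity : ∀ {L X T Ax} → IsLogic L → Interpretation X T Ax → IL⁻ ⊆ L → L ⊆ Th T →
                 (∀ {F} → Ax F → L (tr F)) → ∀ A → L (tr A) ⇔ (Ax ⊢ᵢ A)
conservativity isL 𝓘 IL⁻⊆L L⊆T axioms A =
  mk⇔ (λ ⊢trA → reflect-tr 𝓘 (L⊆T _ ⊢trA)) (tr-sound isL IL⁻⊆L axioms)

corollary4p10 :
    ((L : Fm → Set) → IsLogic L → IL⁻ ⊆ L → L ⊆ Th J5 →
       (A : FmI) → L (tr A) ⇔ (Noneᵢ ⊢ᵢ A))
    × ((L : Fm → Set) → IsLogic L →
       ((Th J4₊ ⊆ L × L ⊆ Th (J4₊ ∪ J5)) ⊎ (Th J4₊ ⊆ L × L ⊆ Th J2₊)) →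
       (A : FmI) → L (tr A) ⇔ (I2 ⊢ᵢ A))
    × ((L : Fm → Set) → IsLogic L → Th (J1 ∪ J4₊) ⊆ L → L ⊆ CL →
       (A : FmI) → L (tr A) ⇔ ((J1ᵘ ∪ᵢ I2) ⊢ᵢ A))
corollary4p10 =
  (λ L isL IL⁻⊆L L⊆J5 → conservativity isL (◇-interpretation ◇-J5) IL⁻⊆L L⊆J5 (λ ()))
  , (λ { L isL (inj₁ (J4₊⊆L , L⊆J4₊J5)) →
           conservativity isL (◇-interpretation [ ◇-J4₊ (I2-derivable-⊇ λ F → F) , ◇-J5 ])
                          (IL⁻⊆ J4₊⊆L) L⊆J4₊J5 (tr-I2∈ J4₊⊆L)
       ; L isL (inj₂ (J4₊⊆L , L⊆J2₊)) →
           conservativity isL (⊥-interpretation (I2-derivable-⊇ λ F → F))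
                          (IL⁻⊆ J4₊⊆L) L⊆J2₊ (tr-I2∈ J4₊⊆L) })
  , λ L isL J1J4₊⊆L L⊆CL →
      conservativity isL (id-interpretation (I2-derivable-⊇ inj₂) (λ a → extra (inj₁ (a , refl))))
                     (IL⁻⊆ J1J4₊⊆L) L⊆CL (tr-J1ᵘ∪I2∈ J1J4₊⊆L)
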